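{- Let $C$ be a symmetric conference matrix of order $n$. Then $H^R=C+i\mathbb{I}$ is a (complex) robust Hadamard matrix.
   Context: A symmetric conference matrix of order $n$ is a real symmetric $n\times n$ matrix $C$ with $C_{jj}=0$, $C_{jk}\in\{1,-1\}$ for $j\ne k$, and $CC^T=(n-1)\mathbb{I}$. A (complex) Hadamard matrix of order $n$ is $H\in M_n(\mathbb{C})$ with $|H_{ij}|=1$ for all $i,j$ and $HH^*=n\mathbb{I}$. $H$ is robust Hadamard if it is Hadamard and for all $i\neq j$ the principal $2\times2$ submatrix $\begin{pmatrix}H_{ii}&H_{ij}\\ H_{ji}&H_{jj}\end{pmatrix}$ is a Hadamard matrix of order $2$. -}

module Defs where

open import Data.Nat using (ℕ; zero; suc)
open import Data.Integer using (ℤ; +_; -_; _-_) renaming (_+_ to _+ℤ_; _*_ to _*ℤ_)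
open import Data.Fin using (Fin; zero; suc; _≟_)
open import Data.Bool using (if_then_else_)
open import Data.Product using (_×_)
open import Data.Sum using (_⊎_)
open import Relation.Nullary using (¬_; does)
open import Relation.Binary.PropositionalEquality using (_≡_)

∑ : {A : Set} → A → (A → A → A) → {n : ℕ} → (Fin n → A) → A
∑ z _⊕_ {zero}  f = z
∑ z _⊕_ {suc n} f = f zero ⊕ ∑ z _⊕_ (λ k → f (suc k))

Matℤ : ℕ → Set
Matℤ n = Fin n → Fin n → ℤ

δℤ : {n : ℕ} → Fin n → Fin n → ℤ
δℤ j k = if does (j ≟ k) then + 1 else + 0

mulTℤ : {n : ℕ} → Matℤ n → Matℤ n
mulTℤ C j k = ∑ (+ 0) _+ℤ_ (λ l → C j l *ℤ C k l)

record SymConference (n : ℕ) (C : Matℤ n) : Set where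
  field
    symmetric : ∀ j k → C j k ≡ C k j
    diagZero  : ∀ j → C j j ≡ + 0
    offDiag   : ∀ j k → ¬ (j ≡ k) → (C j k ≡ + 1) ⊎ (C j k ≡ - (+ 1))
    orthogonal : ∀ j k → mulTℤ C j k ≡ (+ n - + 1) *ℤ δℤ j k

-- Gaussian integers ℤ[i] ⊂ ℂ  (all matrices in the statement live here)

infix 5 _+i_

record ℤ[i] : Set where
  constructor _+i_
  field
    re : ℤ
    im : ℤ
open ℤ[i] public

infixl 6 _⊕_
infixl 7 _⊗_

_⊕_ : ℤ[i] → ℤ[i] → ℤ[i]
(a +i b) ⊕ (c +i d) = (a +ℤ c) +i (b +ℤ d)

_⊗_ : ℤ[i] → ℤ[i] → ℤ[i]
(a +i b) ⊗ (c +i d) = ((a *ℤ c) - (b *ℤ d)) +i ((a *ℤ d) +ℤ (b *ℤ c))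

conj : ℤ[i] → ℤ[i]
conj (a +i b) = a +i (- b)

normSq : ℤ[i] → ℤ
normSq (a +i b) = (a *ℤ a) +ℤ (b *ℤ b)

0ᵍ 1ᵍ iᵍ : ℤ[i]
0ᵍ = + 0 +i + 0
1ᵍ = + 1 +i + 0
iᵍ = + 0 +i + 1

embed : ℤ → ℤ[i]
embed a = a +i + 0

Matᵍ : ℕ → Set
Matᵍ n = Fin n → Fin n → ℤ[i]

Iᵍ : {n : ℕ} → Matᵍ n
Iᵍ j k = if does (j ≟ k) then 1ᵍ else 0ᵍ

mulStar : {n : ℕ} → Matᵍ n → Matᵍ n
mulStar H j k = ∑ 0ᵍ _⊕_ (λ l → H j l ⊗ conj (H k l))

record Hadamard (n : ℕ) (H : Matᵍ n) : Set where
  field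
    unimodular : ∀ j k → normSq (H j k) ≡ + 1
    orthogonal : ∀ j k → mulStar H j k ≡ embed (+ n) ⊗ Iᵍ j k

principal2 : {n : ℕ} → Matᵍ n → Fin n → Fin n → Matᵍ 2
principal2 H j k zero    zero    = H j j
principal2 H j k zero    (suc _) = H j k
principal2 H j k (suc _) zero    = H k j
principal2 H j k (suc _) (suc _) = H k k

record RobustHadamard (n : ℕ) (H : Matᵍ n) : Set where
  field
    hadamard  : Hadamard n H
    principal : ∀ j k → ¬ (j ≡ k) → Hadamard 2 (principal2 H j k)

HR : {n : ℕ} → Matℤ n → Matᵍ n
HR C j k = embed (C j k) ⊕ iᵍ ⊗ Iᵍ j k

-- Write H = C + iI entrywise as C_jk + i δ_jk.  Then (H H*)_jk = (C Cᵀ)_jk + δ_jk + i (C_kj − C_jk),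
-- which is n δ_jk by orthogonality and symmetry of C, and |H_jk|² = C_jk² + δ_jk² = 1.
-- The principal 2×2 submatrices are again of this form, built from the conference matrix
-- [[0, ±1], [±1, 0]] of order 2, so they are Hadamard by the same argument.
module Submission where

open import Data.Nat using (ℕ; zero; suc)
open import Data.Integer using (ℤ; +_; -_; _+_; _-_; _*_)
open import Data.Integer.Properties using (*-comm; *-zeroʳ; *-identityʳ; +-identityˡ; +-identityʳ; +-inverseʳ; +-commutativeSemigroup)
open import Data.Integer.Tactic.RingSolver using (solve-∀)
open import Algebra.Properties.CommutativeSemigroup +-commutativeSemigroup using (interchange)
open import Data.Fin using (Fin; zero; suc; _≟_)
open import Data.Sum using (_⊎_; inj₁; inj₂)
open import Data.Empty using (⊥-elim)
open import Function using (_∘_)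
open import Relation.Nullary using (¬_; yes; no)
open import Relation.Binary.PropositionalEquality
open ≡-Reasoning
open import Defs

∑-cong : ∀ {A : Set} (z : A) (_∙_ : A → A → A) {n} {f g : Fin n → A} →
         (∀ l → f l ≡ g l) → ∑ z _∙_ f ≡ ∑ z _∙_ g
∑-cong z _∙_ {zero}  f≗g = refl
∑-cong z _∙_ {suc n} f≗g = cong₂ _∙_ (f≗g zero) (∑-cong z _∙_ (f≗g ∘ suc))

∑-homomorphic : ∀ {A B : Set} (h : A → B) {z : A} {_∙_ : A → A → A} {z′ : B} {_∙′_ : B → B → B} →
                h z ≡ z′ → (∀ x y → h (x ∙ y) ≡ h x ∙′ h y) →
                ∀ {n} (f : Fin n → A) → h (∑ z _∙_ f) ≡ ∑ z′ _∙′_ (h ∘ f)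
∑-homomorphic h h-z h-∙ {zero}  f = h-z
∑-homomorphic h {_∙′_ = _∙′_} h-z h-∙ {suc n} f =
  trans (h-∙ _ _) (cong (h (f zero) ∙′_) (∑-homomorphic h h-z h-∙ (f ∘ suc)))

∑ℤ : {n : ℕ} → (Fin n → ℤ) → ℤ
∑ℤ = ∑ (+ 0) _+_

∑ℤ-distrib-+ : ∀ {n} (f g : Fin n → ℤ) → ∑ℤ (λ l → f l + g l) ≡ ∑ℤ f + ∑ℤ g
∑ℤ-distrib-+ {zero}  f g = refl
∑ℤ-distrib-+ {suc n} f g =
  trans (cong (_+_ (f zero + g zero)) (∑ℤ-distrib-+ (f ∘ suc) (g ∘ suc)))
        (interchange (f zero) (g zero) _ _)

∑ℤ-distrib-- : ∀ {n} (f g : Fin n → ℤ) → ∑ℤ (λ l → f l - g l) ≡ ∑ℤ f - ∑ℤ g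
∑ℤ-distrib-- {zero}  f g = refl
∑ℤ-distrib-- {suc n} f g =
  trans (cong (_+_ (f zero - g zero)) (∑ℤ-distrib-- (f ∘ suc) (g ∘ suc)))
        (interchange-- (f zero) (g zero) _ _)
  where
  interchange-- : ∀ a b s t → (a - b) + (s - t) ≡ (a + s) - (b + t)
  interchange-- = solve-∀

δℤ-refl : ∀ {n} (j : Fin n) → δℤ j j ≡ + 1
δℤ-refl j with j ≟ j
... | yes _   = refl
... | no j≢j = ⊥-elim (j≢j refl)

δℤ-≢ : ∀ {n} {j k : Fin n} → ¬ j ≡ k → δℤ j k ≡ + 0
δℤ-≢ {j = j} {k} j≢k with j ≟ k
... | yes j≡k = ⊥-elim (j≢k j≡k)
... | no _    = refl

∑ℤ-*-zero : ∀ {n} (f : Fin n → ℤ) → ∑ℤ (λ l → f l * + 0) ≡ + 0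
∑ℤ-*-zero {zero}  f = refl
∑ℤ-*-zero {suc n} f = cong₂ _+_ (*-zeroʳ (f zero)) (∑ℤ-*-zero (f ∘ suc))

∑ℤ-*-δℤ : ∀ {n} (f : Fin n → ℤ) (k : Fin n) → ∑ℤ (λ l → f l * δℤ k l) ≡ f k
∑ℤ-*-δℤ {suc n} f zero = begin
  f zero * + 1 + ∑ℤ (λ l → f (suc l) * + 0) ≡⟨ cong₂ _+_ (*-identityʳ (f zero)) (∑ℤ-*-zero (f ∘ suc)) ⟩
  f zero + + 0                             ≡⟨ +-identityʳ (f zero) ⟩
  f zero                                   ∎
∑ℤ-*-δℤ {suc n} f (suc k) = begin
  f zero * + 0 + ∑ℤ (λ l → f (suc l) * δℤ k l) ≡⟨ cong₂ _+_ (*-zeroʳ (f zero)) (∑ℤ-*-δℤ (f ∘ suc) k) ⟩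
  + 0 + f (suc k)                             ≡⟨ +-identityˡ (f (suc k)) ⟩
  f (suc k)                                   ∎

∑ℤ-δℤ-* : ∀ {n} (f : Fin n → ℤ) (k : Fin n) → ∑ℤ (λ l → δℤ k l * f l) ≡ f k
∑ℤ-δℤ-* f k = trans (∑-cong (+ 0) _+_ (λ l → *-comm (δℤ k l) (f l))) (∑ℤ-*-δℤ f k)

mulTℤ-δℤ : ∀ {n} (j k : Fin n) → mulTℤ δℤ j k ≡ δℤ j k
mulTℤ-δℤ j k = ∑ℤ-*-δℤ (δℤ j) k

Iᵍ-embed : ∀ {n} (j k : Fin n) → Iᵍ j k ≡ embed (δℤ j k)
Iᵍ-embed j k with j ≟ k
... | yes _ = refl
... | no _  = refl

embed-⊗ : ∀ a b → embed a ⊗ embed b ≡ embed (a * b)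
embed-⊗ a b = cong₂ _+i_ (re-part a b) (im-part a b)
  where
  re-part : ∀ a b → a * b - + 0 * + 0 ≡ a * b
  re-part = solve-∀
  im-part : ∀ a b → a * + 0 + + 0 * b ≡ + 0
  im-part = solve-∀

embed-⊕-iᵍ⊗embed : ∀ a b → embed a ⊕ iᵍ ⊗ embed b ≡ a +i b
embed-⊕-iᵍ⊗embed a b = cong₂ _+i_ (re-part a b) (im-part a b)
  where
  re-part : ∀ a b → a + (+ 0 * b - + 1 * + 0) ≡ a
  re-part = solve-∀
  im-part : ∀ a b → + 0 + (+ 0 * + 0 + + 1 * b) ≡ b
  im-part = solve-∀

HR-entry : ∀ {n} (C : Matℤ n) j k → HR C j k ≡ C j k +i δℤ j k
HR-entry C j k = trans (cong (λ z → embed (C j k) ⊕ iᵍ ⊗ z) (Iᵍ-embed j k))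
                       (embed-⊕-iᵍ⊗embed (C j k) (δℤ j k))

mulStar-cong : ∀ {n} {H H′ : Matᵍ n} → (∀ a b → H a b ≡ H′ a b) →
               ∀ j k → mulStar H j k ≡ mulStar H′ j k
mulStar-cong H≗H′ j k = ∑-cong 0ᵍ _⊕_ (λ l → cong₂ (λ x y → x ⊗ conj y) (H≗H′ j l) (H≗H′ k l))

re-mulStar : ∀ {n} (H : Matᵍ n) j k →
             re (mulStar H j k) ≡ mulTℤ (λ a b → re (H a b)) j k + mulTℤ (λ a b → im (H a b)) j k
re-mulStar H j k = begin
  re (mulStar H j k)
    ≡⟨ ∑-homomorphic re refl (λ _ _ → refl) (λ l → H j l ⊗ conj (H k l)) ⟩
  ∑ℤ (λ l → re (H j l ⊗ conj (H k l)))
    ≡⟨ ∑-cong (+ 0) _+_ (λ l → re-⊗-conj (H j l) (H k l)) ⟩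
  ∑ℤ (λ l → re (H j l) * re (H k l) + im (H j l) * im (H k l))
    ≡⟨ ∑ℤ-distrib-+ (λ l → re (H j l) * re (H k l)) (λ l → im (H j l) * im (H k l)) ⟩
  mulTℤ (λ a b → re (H a b)) j k + mulTℤ (λ a b → im (H a b)) j k ∎
  where
  re-⊗-conj : ∀ z w → re (z ⊗ conj w) ≡ re z * re w + im z * im w
  re-⊗-conj (a +i b) (c +i d) = identity a b c d
    where
    identity : ∀ a b c d → a * c - b * (- d) ≡ a * c + b * d
    identity = solve-∀

im-mulStar : ∀ {n} (H : Matᵍ n) j k →
             im (mulStar H j k) ≡ ∑ℤ (λ l → im (H j l) * re (H k l)) - ∑ℤ (λ l → re (H j l) * im (H k l))
im-mulStar H j k = begin
  im (mulStar H j k)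
    ≡⟨ ∑-homomorphic im refl (λ _ _ → refl) (λ l → H j l ⊗ conj (H k l)) ⟩
  ∑ℤ (λ l → im (H j l ⊗ conj (H k l)))
    ≡⟨ ∑-cong (+ 0) _+_ (λ l → im-⊗-conj (H j l) (H k l)) ⟩
  ∑ℤ (λ l → im (H j l) * re (H k l) - re (H j l) * im (H k l))
    ≡⟨ ∑ℤ-distrib-- (λ l → im (H j l) * re (H k l)) (λ l → re (H j l) * im (H k l)) ⟩
  ∑ℤ (λ l → im (H j l) * re (H k l)) - ∑ℤ (λ l → re (H j l) * im (H k l)) ∎
  where
  im-⊗-conj : ∀ z w → im (z ⊗ conj w) ≡ im z * re w - re z * im w
  im-⊗-conj (a +i b) (c +i d) = identity a b c d
    where
    identity : ∀ a b c d → a * (- d) + b * c ≡ b * c - a * d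
    identity = solve-∀

Hadamard-cong : ∀ {n} {H H′ : Matᵍ n} → (∀ a b → H a b ≡ H′ a b) → Hadamard n H → Hadamard n H′
Hadamard-cong H≗H′ had = record
  { unimodular = λ j k → trans (cong normSq (sym (H≗H′ j k))) (unimodular j k)
  ; orthogonal = λ j k → trans (sym (mulStar-cong H≗H′ j k)) (orthogonal j k)
  }
  where open Hadamard had

module _ {n : ℕ} {C : Matℤ n} (conference : SymConference n C) where
  open SymConference conference

  HR-unimodular : ∀ j k → normSq (HR C j k) ≡ + 1
  HR-unimodular j k = trans (cong normSq (HR-entry C j k)) (entry-unimodular j k)
    where
    entry-unimodular : ∀ j k → normSq (C j k +i δℤ j k) ≡ + 1
    entry-unimodular j k with j ≟ k
    ... | yes refl = cong (λ c → normSq (c +i + 1)) (diagZero j)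
    ... | no j≢k with offDiag j k j≢k
    ...   | inj₁ Cjk≡1  = cong (λ c → normSq (c +i + 0)) Cjk≡1
    ...   | inj₂ Cjk≡-1 = cong (λ c → normSq (c +i + 0)) Cjk≡-1

  HR-orthogonal : ∀ j k → mulStar (HR C) j k ≡ embed (+ n) ⊗ Iᵍ j k
  HR-orthogonal j k = begin
    mulStar (HR C) j k                   ≡⟨ mulStar-cong (HR-entry C) j k ⟩
    mulStar (λ a b → C a b +i δℤ a b) j k ≡⟨ cong₂ _+i_ re-part im-part ⟩
    embed (+ n * δℤ j k)                 ≡⟨ sym (embed-⊗ (+ n) (δℤ j k)) ⟩
    embed (+ n) ⊗ embed (δℤ j k)          ≡⟨ cong (embed (+ n) ⊗_) (sym (Iᵍ-embed j k)) ⟩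
    embed (+ n) ⊗ Iᵍ j k                  ∎
    where
    re-part : re (mulStar (λ a b → C a b +i δℤ a b) j k) ≡ + n * δℤ j k
    re-part = begin
      re (mulStar (λ a b → C a b +i δℤ a b) j k) ≡⟨ re-mulStar (λ a b → C a b +i δℤ a b) j k ⟩
      mulTℤ C j k + mulTℤ δℤ j k                 ≡⟨ cong₂ _+_ (orthogonal j k) (mulTℤ-δℤ j k) ⟩
      (+ n - + 1) * δℤ j k + δℤ j k              ≡⟨ identity (+ n) (δℤ j k) ⟩
      + n * δℤ j k                               ∎
      where
      identity : ∀ m d → (m - + 1) * d + d ≡ m * d
      identity = solve-∀
    im-part : im (mulStar (λ a b → C a b +i δℤ a b) j k) ≡ + 0
    im-part = begin
      im (mulStar (λ a b → C a b +i δℤ a b) j k)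
        ≡⟨ im-mulStar (λ a b → C a b +i δℤ a b) j k ⟩
      ∑ℤ (λ l → δℤ j l * C k l) - ∑ℤ (λ l → C j l * δℤ k l)
        ≡⟨ cong₂ _-_ (∑ℤ-δℤ-* (C k) j) (∑ℤ-*-δℤ (C j) k) ⟩
      C k j - C j k
        ≡⟨ cong (_- C j k) (symmetric k j) ⟩
      C j k - C j k
        ≡⟨ +-inverseʳ (C j k) ⟩
      + 0 ∎

  HR-hadamard : Hadamard n (HR C)
  HR-hadamard = record { unimodular = HR-unimodular ; orthogonal = HR-orthogonal }

offDiagonal₂ : ℤ → Matℤ 2
offDiagonal₂ c zero    zero    = + 0
offDiagonal₂ c zero    (suc _) = c
offDiagonal₂ c (suc _) zero    = c
offDiagonal₂ c (suc _) (suc _) = + 0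

offDiagonal₂-conference : ∀ {c} → (c ≡ + 1) ⊎ (c ≡ - (+ 1)) → SymConference 2 (offDiagonal₂ c)
offDiagonal₂-conference {c} c≡±1 = record
  { symmetric  = symmetric
  ; diagZero   = λ { zero → refl ; (suc zero) → refl }
  ; offDiag    = offDiag
  ; orthogonal = orthogonal c≡±1
  }
  where
  symmetric : ∀ j k → offDiagonal₂ c j k ≡ offDiagonal₂ c k j
  symmetric zero       zero       = refl
  symmetric zero       (suc zero) = refl
  symmetric (suc zero) zero       = refl
  symmetric (suc zero) (suc zero) = refl
  offDiag : ∀ j k → ¬ j ≡ k → (offDiagonal₂ c j k ≡ + 1) ⊎ (offDiagonal₂ c j k ≡ - (+ 1))
  offDiag zero       zero       j≢k = ⊥-elim (j≢k refl)
  offDiag zero       (suc zero) _   = c≡±1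
  offDiag (suc zero) zero       _   = c≡±1
  offDiag (suc zero) (suc zero) j≢k = ⊥-elim (j≢k refl)
  orthogonal : (c ≡ + 1) ⊎ (c ≡ - (+ 1)) → ∀ j k → mulTℤ (offDiagonal₂ c) j k ≡ (+ 2 - + 1) * δℤ j k
  orthogonal (inj₁ refl) zero       zero       = refl
  orthogonal (inj₁ refl) zero       (suc zero) = refl
  orthogonal (inj₁ refl) (suc zero) zero       = refl
  orthogonal (inj₁ refl) (suc zero) (suc zero) = refl
  orthogonal (inj₂ refl) zero       zero       = refl
  orthogonal (inj₂ refl) zero       (suc zero) = refl
  orthogonal (inj₂ refl) (suc zero) zero       = refl
  orthogonal (inj₂ refl) (suc zero) (suc zero) = refl

principal2-HR : ∀ {n} {C : Matℤ n} → SymConference n C → ∀ {j k} → ¬ j ≡ k →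
                ∀ a b → principal2 (HR C) j k a b ≡ HR (offDiagonal₂ (C j k)) a b
principal2-HR {C = C} conference {j} {k} j≢k = λ where
    zero       zero       → diagonal j
    zero       (suc zero) → begin
      HR C j k        ≡⟨ HR-entry C j k ⟩
      C j k +i δℤ j k ≡⟨ cong (C j k +i_) (δℤ-≢ j≢k) ⟩
      C j k +i + 0    ≡⟨ sym (HR-entry (offDiagonal₂ (C j k)) zero (suc zero)) ⟩
      HR (offDiagonal₂ (C j k)) zero (suc zero) ∎
    (suc zero) zero       → begin
      HR C k j        ≡⟨ HR-entry C k j ⟩
      C k j +i δℤ k j ≡⟨ cong₂ _+i_ (symmetric k j) (δℤ-≢ (j≢k ∘ sym)) ⟩
      C j k +i + 0    ≡⟨ sym (HR-entry (offDiagonal₂ (C j k)) (suc zero) zero) ⟩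
      HR (offDiagonal₂ (C j k)) (suc zero) zero ∎
    (suc zero) (suc zero) → diagonal k
  where
  open SymConference conference
  diagonal : ∀ i → HR C i i ≡ + 0 +i + 1
  diagonal i = trans (HR-entry C i i) (cong₂ _+i_ (diagZero i) (δℤ-refl i))

mainTheorem4 : (n : ℕ) (C : Matℤ n) → SymConference n C → RobustHadamard n (HR C)
mainTheorem4 n C conference = record
  { hadamard  = HR-hadamard conference
  ; principal = λ j k j≢k →
      Hadamard-cong (λ a b → sym (principal2-HR conference j≢k a b))
                    (HR-hadamard (offDiagonal₂-conference (SymConference.offDiag conference j k j≢k)))
  }
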